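{- Let $r,c,t$ be positive integers. For each $T_{bottom}\in Bottom(r,c,t)$, the interval $[T_{bottom},T_{top}]$ in $SSYT(r,c,t)$ is a Boolean algebra, and as a set $SSYT(r,c,t)=\bigcup_{T_{bottom}\in Bottom(r,c,t)}[T_{bottom},T_{top}]$, the union being disjoint.
   Context: $SSYT(r,c,t)$ is the set of $r\times c$ arrays $T$ (rows $1,\dots,r$ top to bottom) with entries in $\{0,\dots,r+t-1\}$, weakly increasing along rows and strictly increasing down columns, partially ordered entrywise. An occurrence of $v$ in row $R$, column $j$, is free if $R=1$ or the entry directly above is not $v-1$. $D(T)$ is the set of pairs $(R,i)$ with $i$ odd occurring in row $R$ with an odd number of free occurrences (such an $i$ may be decremented: replace the leftmost $i$ in row $R$ by $i-1$). $E(T)$ is the set of pairs $(R,i)$ with $i$ even, $i<r+t-1$, $i$ occurring in row $R$, the rightmost $i$ in row $R$ not having $i+1$ immediately below it (vacuous if $R=r$), and the number of free occurrences of $i+1$ in row $R$ even (possibly zero) (such an $i$ may be incremented: replace the rightmost $i$ in row $R$ by $i+1$). $Bottom(r,c,t)=\{T\in SSYT(r,c,t): D(T)=\varnothing\}$. For $T_{bottom}\in Bottom(r,c,t)$, $T_{top}$ is the array obtained from $T_{bottom}$ by performing the increment for every $(R,i)\in E(T_{bottom})$. -}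

module Defs where

open import Data.Nat using (ℕ; zero; suc; _+_; _≤_; _<_; _≡ᵇ_; _<ᵇ_; _%_)
open import Data.Bool using (Bool; true; false; _∧_; _∨_; not; if_then_else_)
open import Data.Fin using (Fin; zero; suc; inject₁; toℕ) renaming (_≤_ to _≤ᶠ_; _<_ to _<ᶠ_)
open import Data.Fin.Subset using (Subset; _⊆_)
open import Data.List using (List; length; filterᵇ; allFin)
open import Data.Bool.ListAction using (all; any)
open import Data.Maybe using (Maybe; just; nothing)
import Data.Maybe as Maybe
open import Data.Product using (Σ; _×_; proj₁)
open import Function.Bundles using (_⇔_)
open import Relation.Binary.PropositionalEquality using (_≡_)

-- An r × c array: rows Fin r (row `zero` is the top row 1), columns Fin c.
Array : ℕ → ℕ → Set
Array r c = Fin r → Fin c → ℕ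

above : ∀ {n} → Fin n → Maybe (Fin n)
above zero    = nothing
above (suc k) = just (inject₁ k)

below : ∀ {n} → Fin n → Maybe (Fin n)
below {suc zero}    zero    = nothing
below {suc (suc n)} zero    = just (suc zero)
below {suc (suc n)} (suc k) = Maybe.map suc (below k)

IsSSYT : (r c t : ℕ) → Array r c → Set
IsSSYT r c t T =
  (∀ R j → T R j < r + t) ×
  (∀ R j j′ → j ≤ᶠ j′ → T R j ≤ T R j′) ×
  (∀ R R′ j → R <ᶠ R′ → T R j < T R′ j)

_≤A_ : ∀ {r c} → Array r c → Array r c → Set
T ≤A U = ∀ R j → T R j ≤ U R j

_≋_ : ∀ {r c} → Array r c → Array r c → Set
T ≋ U = ∀ R j → T R j ≡ U R j

isOdd : ℕ → Bool
isOdd n = n % 2 ≡ᵇ 1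

isEven : ℕ → Bool
isEven n = not (isOdd n)

isFree : ∀ {r c} → Array r c → Fin r → Fin c → Bool
isFree T R j with above R
... | nothing = true
... | just R′ = not (suc (T R′ j) ≡ᵇ T R j)

freeCount : ∀ {r c} → Array r c → Fin r → ℕ → ℕ
freeCount {c = c} T R v =
  length (filterᵇ (λ j → (T R j ≡ᵇ v) ∧ isFree T R j) (allFin c))

occurs : ∀ {r c} → Array r c → Fin r → ℕ → Bool
occurs {c = c} T R v = any (λ j → T R j ≡ᵇ v) (allFin c)

isRightmost : ∀ {r c} → Array r c → Fin r → ℕ → Fin c → Bool
isRightmost {c = c} T R i j =
  (T R j ≡ᵇ i) ∧ all (λ j′ → not (toℕ j <ᵇ toℕ j′) ∨ not (T R j′ ≡ᵇ i)) (allFin c)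

noSuccBelow : ∀ {r c} → Array r c → Fin r → ℕ → Fin c → Bool
noSuccBelow T R i j with below R
... | nothing = true
... | just R′ = not (T R′ j ≡ᵇ suc i)

inD : ∀ {r c} → Array r c → Fin r → ℕ → Bool
inD T R i = isOdd i ∧ occurs T R i ∧ isOdd (freeCount T R i)

inE : (r t : ℕ) → ∀ {c} → Array r c → Fin r → ℕ → Bool
inE r t {c} T R i =
  isEven i ∧ (suc i <ᵇ r + t) ∧ occurs T R i ∧
  all (λ j → not (isRightmost T R i j) ∨ noSuccBelow T R i j) (allFin c) ∧
  isEven (freeCount T R (suc i))

Top : (r t : ℕ) → ∀ {c} → Array r c → Array r c
Top r t T R j =
  if inE r t T R (T R j) ∧ isRightmost T R (T R j) j
  then suc (T R j) else T R j

IsBottom : (r c t : ℕ) → Array r c → Set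
IsBottom r c t T = IsSSYT r c t T × (∀ R i → inD T R i ≡ false)

InInterval : (r c t : ℕ) → Array r c → Array r c → Array r c → Set
InInterval r c t B U T = IsSSYT r c t T × B ≤A T × T ≤A U

Interval : (r c t : ℕ) → Array r c → Array r c → Set
Interval r c t B U = Σ (Array r c) (InInterval r c t B U)

-- The interval [B,U] is a Boolean algebra: it is order-isomorphic to the
-- lattice of subsets of some finite set {0,…,n-1} ordered by inclusion.
record IsBooleanInterval (r c t : ℕ) (B U : Array r c) : Set where
  field
    n        : ℕ
    to       : Interval r c t B U → Subset n
    from     : Subset n → Interval r c t B U
    from∘to  : ∀ x → proj₁ (from (to x)) ≋ proj₁ x
    to∘from  : ∀ s → to (from s) ≡ s
    monotone : ∀ x y → (proj₁ x ≤A proj₁ y) ⇔ (to x ⊆ to y)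

module Submission where

-- Raising the rightmost i to i + 1 for every (R, i) in a set X of E-cells of an
-- SSYT B keeps it semistandard, and changes the number of free occurrences of an
-- odd value o in a row by one exactly when a raised cell becomes o; the parity
-- conditions defining E ensure that no other occurrence gains or loses freeness.
-- Hence if D(B) = ∅ the D-cells of raise B X are exactly X, and lowering them
-- recovers B. Every T in [B, T_top] is raise B X for the subset X of E-cells
-- where T differs from B, so the interval is Boolean and determines B as the
-- lowering of T. Conversely, lowering the D-cells of an arbitrary SSYT T gives a
-- tableau B with D(B) = ∅ whose E-cells contain the lowered ones, so T ∈ [B, T_top].

open import Data.Bool using (Bool; true; false; _∧_; _∨_; not; if_then_else_)
import Data.Bool.Properties as Bool
open import Data.Bool.ListAction using (all; any)
open import Data.Empty using (⊥-elim)
open import Data.Fin using (Fin; zero; suc; toℕ; inject₁; combine; remQuot)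
open import Data.Fin.Properties
  using (toℕ-injective; toℕ-inject₁; any?; remQuot-combine; combine-remQuot)
  renaming (suc-injective to fsuc-injective)
open import Data.Fin.Subset using (Subset; _⊆_)
open import Data.List using (tabulate; filterᵇ; length; allFin)
open import Data.Maybe using (Maybe; just; nothing)
import Data.Maybe as Maybe
open import Data.Nat using (ℕ; zero; suc; pred; _+_; _*_; _≤_; _<_; _≡ᵇ_; _<ᵇ_; s≤s; s≤s⁻¹)
open import Data.Nat.Properties
open import Data.Product using (∃; _×_; _,_; proj₁; proj₂; uncurry)
open import Data.Sum using (_⊎_; inj₁; inj₂)
import Data.Vec as Vec
open import Data.Vec.Properties
  using (lookup∘tabulate; tabulate∘lookup; tabulate-cong; []=⇒lookup; lookup⇒[]=)
open import Function using (_∘_; id)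
open import Function.Bundles using (_⇔_; mk⇔)
open import Function.Construct.Composition using (_⇔-∘_)
open import Relation.Binary.Definitions using (tri<; tri≈; tri>)
open import Relation.Binary.PropositionalEquality
open import Relation.Nullary using (¬_; yes; no; contradiction)
open import Relation.Nullary.Decidable using (_×-dec_)
open import Relation.Nullary.Reflects
  using (Reflects; ofʸ; ofⁿ; _×-reflects_; _⊎-reflects_; _→-reflects_; ¬-reflects; fromEquivalence)

open import Defs

private variable
  P Q : Set
  a b : Bool
  m n : ℕ

reflects-true⇒ : Reflects P b → b ≡ true → P
reflects-true⇒ (ofʸ p) _ = p
reflects-true⇒ (ofⁿ _) ()

reflects-false⇒ : Reflects P b → b ≡ false → ¬ P
reflects-false⇒ (ofⁿ ¬p) _ = ¬p
reflects-false⇒ (ofʸ _) ()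

reflects-⇒true : Reflects P b → P → b ≡ true
reflects-⇒true (ofʸ _) _ = refl
reflects-⇒true (ofⁿ ¬p) p = contradiction p ¬p

reflects-⇒false : Reflects P b → ¬ P → b ≡ false
reflects-⇒false (ofⁿ _) _ = refl
reflects-⇒false (ofʸ p) ¬p = contradiction p ¬p

reflects-map : (P → Q) → (Q → P) → Reflects P b → Reflects Q b
reflects-map f g (ofʸ p) = ofʸ (f p)
reflects-map f g (ofⁿ ¬p) = ofⁿ (¬p ∘ g)

reflects-≡ : Reflects P a → Reflects Q b → (P → Q) → (Q → P) → a ≡ b
reflects-≡ (ofʸ _) (ofʸ _) f g = refl
reflects-≡ (ofⁿ _) (ofⁿ _) f g = refl
reflects-≡ (ofʸ p) (ofⁿ ¬q) f g = contradiction (f p) ¬q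
reflects-≡ (ofⁿ ¬p) (ofʸ q) f g = contradiction (g q) ¬p

≡ᵇ-reflects-≡ : ∀ m n → Reflects (m ≡ n) (m ≡ᵇ n)
≡ᵇ-reflects-≡ m n = fromEquivalence (≡ᵇ⇒≡ m n) (≡⇒≡ᵇ m n)

false-reflects-not : ∀ b → Reflects (b ≡ false) (not b)
false-reflects-not true = ofⁿ λ ()
false-reflects-not false = ofʸ refl

true-or-false : ∀ b → b ≡ true ⊎ b ≡ false
true-or-false true = inj₁ refl
true-or-false false = inj₂ refl

true-reflects : ∀ b → Reflects (b ≡ true) b
true-reflects true = ofʸ refl
true-reflects false = ofⁿ λ ()

all-tabulate-reflects : {A : Set} {Pr : A → Set} {p : A → Bool} (f : Fin n → A) →
  (∀ x → Reflects (Pr x) (p x)) → Reflects (∀ k → Pr (f k)) (all p (tabulate f))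
all-tabulate-reflects {zero} f r = ofʸ λ ()
all-tabulate-reflects {suc n} f r =
  reflects-map (λ (h , hs) → λ { zero → h ; (suc k) → hs k }) (λ h → h zero , h ∘ suc)
    (r (f zero) ×-reflects all-tabulate-reflects (f ∘ suc) r)

any-tabulate-reflects : {A : Set} {Pr : A → Set} {p : A → Bool} (f : Fin n → A) →
  (∀ x → Reflects (Pr x) (p x)) → Reflects (∃ λ k → Pr (f k)) (any p (tabulate f))
any-tabulate-reflects {zero} f r = ofⁿ λ ()
any-tabulate-reflects {suc n} f r =
  reflects-map (λ { (inj₁ h) → zero , h ; (inj₂ (k , h)) → suc k , h })
               (λ { (zero , h) → inj₁ h ; (suc k , h) → inj₂ (k , h) })
    (r (f zero) ⊎-reflects any-tabulate-reflects (f ∘ suc) r)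

isOdd-suc : ∀ n → isOdd (suc n) ≡ not (isOdd n)
isOdd-suc zero = refl
isOdd-suc (suc zero) = refl
isOdd-suc (suc (suc n)) = isOdd-suc n

even⇒suc-odd : isOdd n ≡ false → isOdd (suc n) ≡ true
even⇒suc-odd {n} e = trans (isOdd-suc n) (cong not e)

suc-odd⇒even : isOdd (suc n) ≡ true → isOdd n ≡ false
suc-odd⇒even {n} o = Bool.not-injective (trans (sym (isOdd-suc n)) o)

parity⇒≢ : isOdd m ≡ false → isOdd n ≡ true → m ≢ n
parity⇒≢ e o refl = contradiction (trans (sym e) o) λ ()

count : (Fin n → Bool) → ℕ
count {zero} p = 0
count {suc n} p = (if p zero then 1 else 0) + count (p ∘ suc)

length-filterᵇ-tabulate : {A : Set} (p : A → Bool) (f : Fin n → A) →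
  length (filterᵇ p (tabulate f)) ≡ count (p ∘ f)
length-filterᵇ-tabulate {zero} p f = refl
length-filterᵇ-tabulate {suc n} p f with p (f zero)
... | true = cong suc (length-filterᵇ-tabulate p (f ∘ suc))
... | false = length-filterᵇ-tabulate p (f ∘ suc)

count-cong : {p q : Fin n → Bool} → (∀ k → p k ≡ q k) → count p ≡ count q
count-cong {zero} e = refl
count-cong {suc n} e = cong₂ _+_ (cong (if_then 1 else 0) (e zero)) (count-cong (e ∘ suc))

count-false : {p : Fin n → Bool} → (∀ k → p k ≡ false) → count p ≡ 0
count-false {zero} e = refl
count-false {suc n} {p} e rewrite e zero = count-false (e ∘ suc)

count≢0⇒witness : (p : Fin n → Bool) → count p ≢ 0 → ∃ λ k → p k ≡ true
count≢0⇒witness {zero} p c≢0 = contradiction refl c≢0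
count≢0⇒witness {suc n} p c≢0 with p zero in e
... | true = zero , e
... | false = let k , h = count≢0⇒witness (p ∘ suc) c≢0 in suc k , h

count-insert : {p q : Fin n → Bool} (k₀ : Fin n) → p k₀ ≡ true → q k₀ ≡ false →
  (∀ k → k ≢ k₀ → p k ≡ q k) → count p ≡ suc (count q)
count-insert {suc n} zero pt qf e rewrite pt | qf = cong suc (count-cong (λ k → e (suc k) λ ()))
count-insert {suc n} {p} {q} (suc k₀) pt qf e rewrite e zero (λ ()) with q zero
... | true = cong suc (count-insert k₀ pt qf λ k k≢k₀ → e (suc k) (k≢k₀ ∘ fsuc-injective))
... | false = count-insert k₀ pt qf λ k k≢k₀ → e (suc k) (k≢k₀ ∘ fsuc-injective)

leftmost-witness : (p : Fin n → Bool) (k : Fin n) → p k ≡ true →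
  ∃ λ k₀ → p k₀ ≡ true × ∀ k → toℕ k < toℕ k₀ → p k ≡ false
leftmost-witness {suc n} p k pk with p zero in e
... | true = zero , e , λ k ()
leftmost-witness {suc n} p zero pk | false = contradiction (trans (sym pk) e) λ ()
leftmost-witness {suc n} p (suc k) pk | false =
  let k₀ , pk₀ , left = leftmost-witness (p ∘ suc) k pk
  in suc k₀ , pk₀ , λ { zero _ → e ; (suc k′) (s≤s k′<k₀) → left k′ k′<k₀ }

record Enumeration {m : ℕ} (f : Fin m → Bool) : Set where
  field
    size          : ℕ
    elem          : Fin size → Fin m
    index         : Fin m → Maybe (Fin size)
    elem-true     : ∀ k → f (elem k) ≡ true
    index-elem    : ∀ k → index (elem k) ≡ just k
    elem-index    : ∀ {i k} → index i ≡ just k → elem k ≡ i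
    index-nothing : ∀ {i} → index i ≡ nothing → f i ≡ false

module _ {m : ℕ} {f : Fin (suc m) → Bool} (E : Enumeration (f ∘ suc)) where
  open Enumeration E

  enumeration-skip : f zero ≡ false → Enumeration f
  enumeration-skip f₀ = record
    { size = size
    ; elem = suc ∘ elem
    ; index = λ { zero → nothing ; (suc i) → index i }
    ; elem-true = elem-true
    ; index-elem = index-elem
    ; elem-index = λ { {suc i} e → cong suc (elem-index e) }
    ; index-nothing = λ { {zero} _ → f₀ ; {suc i} e → index-nothing e } }

  enumeration-keep : f zero ≡ true → Enumeration f
  enumeration-keep f₀ = record
    { size = suc size
    ; elem = elem′
    ; index = index′
    ; elem-true = λ { zero → f₀ ; (suc k) → elem-true k }
    ; index-elem = λ { zero → refl ; (suc k) → cong (Maybe.map suc) (index-elem k) }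
    ; elem-index = elem-index′
    ; index-nothing = index-nothing′ }
    where
    elem′ : Fin (suc size) → Fin (suc m)
    elem′ zero = zero
    elem′ (suc k) = suc (elem k)
    index′ : Fin (suc m) → Maybe (Fin (suc size))
    index′ zero = just zero
    index′ (suc i) = Maybe.map suc (index i)
    elem-index′ : ∀ {i k} → index′ i ≡ just k → elem′ k ≡ i
    elem-index′ {zero} refl = refl
    elem-index′ {suc i} e with index i in eq
    elem-index′ {suc i} refl | just k = cong suc (elem-index eq)
    index-nothing′ : ∀ {i} → index′ i ≡ nothing → f i ≡ false
    index-nothing′ {suc i} e with index i in eq
    ... | nothing = index-nothing eq

enumerate : ∀ {m} (f : Fin m → Bool) → Enumeration f
enumerate {zero} f = record
  { size = 0 ; elem = λ () ; index = λ () ; elem-true = λ ()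
  ; index-elem = λ () ; elem-index = λ { {()} } ; index-nothing = λ { {()} } }
enumerate {suc m} f with f zero in f₀
... | true = enumeration-keep (enumerate (f ∘ suc)) f₀
... | false = enumeration-skip (enumerate (f ∘ suc)) f₀

toℕ-below : {R R′ : Fin n} → below R ≡ just R′ → toℕ R′ ≡ suc (toℕ R)
toℕ-below {suc (suc n)} {zero} refl = refl
toℕ-below {suc (suc n)} {suc R} e with below R in e′
toℕ-below {suc (suc n)} {suc R} refl | just R′ = cong suc (toℕ-below e′)

below-exists : {R R′ : Fin n} → toℕ R < toℕ R′ → ∃ λ R₁ → below R ≡ just R₁
below-exists {suc zero} {zero} {zero} ()
below-exists {suc (suc n)} {zero} _ = suc zero , refl
below-exists {suc (suc n)} {suc R} {suc R′} (s≤s R<R′) with below-exists {R = R} {R′} R<R′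
... | R₁ , e rewrite e = suc R₁ , refl

toℕ-above : {R R′ : Fin n} → above R ≡ just R′ → toℕ R ≡ suc (toℕ R′)
toℕ-above {R = suc R} refl = cong suc (sym (toℕ-inject₁ R))

above-exists : {R R′ : Fin n} → toℕ R < toℕ R′ → ∃ λ R₀ → above R′ ≡ just R₀
above-exists {R′ = suc R′} _ = inject₁ R′ , refl

above⇒below : {R R′ : Fin n} → above R ≡ just R′ → below R′ ≡ just R
above⇒below {R = R} {R′} e
  with below-exists {R = R′} {R} (≤-reflexive (sym (toℕ-above e)))
... | R₁ , e₁ = subst (λ R″ → below R′ ≡ just R″)
      (toℕ-injective (trans (toℕ-below e₁) (sym (toℕ-above e)))) e₁

module _ {r c : ℕ} where

  Free : Array r c → Fin r → Fin c → Set
  Free T R j = ∀ R′ → above R ≡ just R′ → suc (T R′ j) ≢ T R j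

  FreeOcc : Array r c → Fin r → ℕ → Fin c → Set
  FreeOcc T R v j = T R j ≡ v × Free T R j

  RightmostOf LeftmostOf : Array r c → Fin r → ℕ → Fin c → Set
  RightmostOf T R i j = T R j ≡ i × ∀ j′ → toℕ j < toℕ j′ → T R j′ ≢ i
  LeftmostOf T R i j = T R j ≡ i × ∀ j′ → toℕ j′ < toℕ j → T R j′ ≢ i

  SuccNotBelow : Array r c → Fin r → ℕ → Fin c → Set
  SuccNotBelow T R i j = ∀ R′ → below R ≡ just R′ → T R′ j ≢ suc i

  rightmost-unique : ∀ {T R i j j′} → RightmostOf T R i j → RightmostOf T R i j′ → j ≡ j′
  rightmost-unique {j = j} {j′} (e , right) (e′ , right′) with <-cmp (toℕ j) (toℕ j′)
  ... | tri< j<j′ _ _ = contradiction e′ (right j′ j<j′)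
  ... | tri≈ _ j≡j′ _ = toℕ-injective j≡j′
  ... | tri> _ _ j′<j = contradiction e (right′ j j′<j)

  freeOcc : Array r c → Fin r → ℕ → Fin c → Bool
  freeOcc T R v j = (T R j ≡ᵇ v) ∧ isFree T R j

  isLeftmost : Array r c → Fin r → ℕ → Fin c → Bool
  isLeftmost T R i j = (T R j ≡ᵇ i) ∧ all (λ j′ → not (toℕ j′ <ᵇ toℕ j) ∨ not (T R j′ ≡ᵇ i)) (allFin c)

  isFree-reflects : ∀ T R j → Reflects (Free T R j) (isFree T R j)
  isFree-reflects T zero j = ofʸ λ _ ()
  isFree-reflects T (suc R) j =
    reflects-map (λ { h _ refl → h }) (λ h → h _ refl) (¬-reflects (≡ᵇ-reflects-≡ _ _))

  freeOcc-reflects : ∀ T R v j → Reflects (FreeOcc T R v j) (freeOcc T R v j)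
  freeOcc-reflects T R v j = ≡ᵇ-reflects-≡ _ _ ×-reflects isFree-reflects T R j

  freeCount≡count : ∀ T R v → freeCount T R v ≡ count (freeOcc T R v)
  freeCount≡count T R v = length-filterᵇ-tabulate (freeOcc T R v) id

  occurs-reflects : ∀ (T : Array r c) R v → Reflects (∃ λ j → T R j ≡ v) (occurs T R v)
  occurs-reflects T R v = any-tabulate-reflects id (λ j → ≡ᵇ-reflects-≡ (T R j) v)

  isRightmost-reflects : ∀ T R i j → Reflects (RightmostOf T R i j) (isRightmost T R i j)
  isRightmost-reflects T R i j = ≡ᵇ-reflects-≡ _ _ ×-reflects
    all-tabulate-reflects id (λ j′ → <ᵇ-reflects-< _ _ →-reflects ¬-reflects (≡ᵇ-reflects-≡ _ _))

  isLeftmost-reflects : ∀ T R i j → Reflects (LeftmostOf T R i j) (isLeftmost T R i j)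
  isLeftmost-reflects T R i j = ≡ᵇ-reflects-≡ _ _ ×-reflects
    all-tabulate-reflects id (λ j′ → <ᵇ-reflects-< _ _ →-reflects ¬-reflects (≡ᵇ-reflects-≡ _ _))

  noSuccBelow-reflects : ∀ T R i j → Reflects (SuccNotBelow T R i j) (noSuccBelow T R i j)
  noSuccBelow-reflects T R i j with below R
  ... | nothing = ofʸ λ _ ()
  ... | just R′ = reflects-map (λ { h _ refl → h }) (λ h → h _ refl)
        (¬-reflects (≡ᵇ-reflects-≡ (T R′ j) (suc i)))

  InD : Array r c → Fin r → ℕ → Set
  InD T R i = isOdd i ≡ true × (∃ λ j → T R j ≡ i) × isOdd (freeCount T R i) ≡ true

  inD-reflects : ∀ T R i → Reflects (InD T R i) (inD T R i)
  inD-reflects T R i =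
    true-reflects (isOdd i) ×-reflects occurs-reflects T R i ×-reflects true-reflects _

  InE : ℕ → Array r c → Fin r → ℕ → Set
  InE t T R i = isOdd i ≡ false × suc i < r + t × (∃ λ j → T R j ≡ i) ×
    (∀ j → RightmostOf T R i j → SuccNotBelow T R i j) × isOdd (freeCount T R (suc i)) ≡ false

  inE-reflects : ∀ t T R i → Reflects (InE t T R i) (inE r t T R i)
  inE-reflects t T R i =
    false-reflects-not (isOdd i) ×-reflects <ᵇ-reflects-< _ _ ×-reflects occurs-reflects T R i ×-reflects
    all-tabulate-reflects id (λ j → isRightmost-reflects T R i j →-reflects noSuccBelow-reflects T R i j) ×-reflects
    false-reflects-not _

module SSYT {r c t : ℕ} {T : Array r c} (ssyt : IsSSYT r c t T) where

  bounded : ∀ R j → T R j < r + t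
  bounded = proj₁ ssyt

  row-mono : ∀ R {j j′} → toℕ j ≤ toℕ j′ → T R j ≤ T R j′
  row-mono R {j} {j′} = proj₁ (proj₂ ssyt) R j j′

  col-strict : ∀ {R R′} j → toℕ R < toℕ R′ → T R j < T R′ j
  col-strict {R} {R′} j = proj₂ (proj₂ ssyt) R R′ j

  col-mono : ∀ {R R′} j → toℕ R ≤ toℕ R′ → T R j ≤ T R′ j
  col-mono {R} {R′} j R≤R′ with m≤n⇒m<n∨m≡n R≤R′
  ... | inj₁ R<R′ = <⇒≤ (col-strict j R<R′)
  ... | inj₂ R≡R′ rewrite toℕ-injective R≡R′ = ≤-refl

  <-below : ∀ {R R′} j → below R ≡ just R′ → T R j < T R′ j
  <-below j e = col-strict j (≤-reflexive (sym (toℕ-below e)))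

  >-above : ∀ {R R′} j → above R ≡ just R′ → T R′ j < T R j
  >-above j e = col-strict j (≤-reflexive (sym (toℕ-above e)))

Cells : ℕ → ℕ → Set
Cells r c = Fin r → Fin c → Bool

_⊆ᶜ_ : ∀ {r c} → Cells r c → Cells r c → Set
X ⊆ᶜ Y = ∀ R j → X R j ≡ true → Y R j ≡ true

module _ {r c : ℕ} where

  raise : Array r c → Cells r c → Array r c
  raise B X R j = if X R j then suc (B R j) else B R j

  raise-true : ∀ B X {R j} → X R j ≡ true → raise B X R j ≡ suc (B R j)
  raise-true B X e rewrite e = refl

  raise-false : ∀ B X {R j} → X R j ≡ false → raise B X R j ≡ B R j
  raise-false B X e rewrite e = refl

  ≤-raise : ∀ B X → B ≤A raise B X
  ≤-raise B X R j with X R j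
  ... | true = n≤1+n _
  ... | false = ≤-refl

  raise-mono : ∀ B {X Y} → X ⊆ᶜ Y → raise B X ≤A raise B Y
  raise-mono B {X} {Y} X⊆Y R j with X R j in x
  ... | true rewrite X⊆Y R j x = ≤-refl
  ... | false = ≤-raise B Y R j

  raise-≤⇒⊆ : ∀ B {X Y} → raise B X ≤A raise B Y → X ⊆ᶜ Y
  raise-≤⇒⊆ B {X} {Y} le R j x with true-or-false (Y R j)
  ... | inj₁ y = y
  ... | inj₂ y = contradiction (subst₂ _≤_ (raise-true B X x) (raise-false B Y y) (le R j)) 1+n≰n

  -- The cells incremented in passing to T_top: Top r t B is raise B (liftCells t B) by definition.
  liftCells : ℕ → Array r c → Cells r c
  liftCells t B R j = inE r t B R (B R j) ∧ isRightmost B R (B R j) j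

-- The conditions defining E(B), read at the incremented cell, except the parity of
-- free counts.
record Liftable {r c : ℕ} (t : ℕ) (B : Array r c) (X : Cells r c) : Set where
  field
    even         : ∀ {R j} → X R j ≡ true → isOdd (B R j) ≡ false
    rightmost    : ∀ {R j} → X R j ≡ true → ∀ j′ → toℕ j < toℕ j′ → B R j′ ≢ B R j
    succNotBelow : ∀ {R j} → X R j ≡ true → SuccNotBelow B R (B R j) j
    bounded      : ∀ {R j} → X R j ≡ true → suc (B R j) < r + t

module _ {r c t : ℕ} where

  liftable-⊆ : ∀ {B : Array r c} {X Y : Cells r c} → Liftable t B X → Y ⊆ᶜ X → Liftable t B Y
  liftable-⊆ L Y⊆X = record
    { even = λ {R} {j} → even ∘ Y⊆X R j
    ; rightmost = λ {R} {j} → rightmost ∘ Y⊆X R j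
    ; succNotBelow = λ {R} {j} → succNotBelow ∘ Y⊆X R j
    ; bounded = λ {R} {j} → bounded ∘ Y⊆X R j }
    where open Liftable L

  liftCells-liftable : ∀ (B : Array r c) → Liftable t B (liftCells t B)
  liftCells-liftable B = record
    { even = λ x → proj₁ (inE-of x)
    ; rightmost = λ x → proj₂ (rightmost-of x)
    ; succNotBelow = λ x → proj₁ (proj₂ (proj₂ (proj₂ (inE-of x)))) _ (rightmost-of x)
    ; bounded = λ x → proj₁ (proj₂ (inE-of x)) }
    where
    inE-of : ∀ {R j} → liftCells t B R j ≡ true → InE t B R (B R j)
    inE-of {R} {j} x = reflects-true⇒ (inE-reflects t B R (B R j))
        (Bool.∧-conicalˡ (inE r t B R (B R j)) _ x)
    rightmost-of : ∀ {R j} → liftCells t B R j ≡ true → RightmostOf B R (B R j) j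
    rightmost-of {R} {j} x = reflects-true⇒ (isRightmost-reflects B R (B R j) j)
        (Bool.∧-conicalʳ (inE r t B R (B R j)) _ x)

  module _ {B : Array r c} {X : Cells r c} (sB : IsSSYT r c t B) (L : Liftable t B X) where
    open Liftable L
    open SSYT sB using (row-mono; col-strict; col-mono; <-below)

    <-right-of-lifted : ∀ {R j} j′ → X R j ≡ true → toℕ j < toℕ j′ → B R j < B R j′
    <-right-of-lifted {R} j′ x j<j′ = ≤∧≢⇒< (row-mono R (<⇒≤ j<j′)) (λ e → rightmost x j′ j<j′ (sym e))

    suc<-under-lifted : ∀ {R R′ j} → X R j ≡ true → toℕ R < toℕ R′ → suc (B R j) < B R′ j
    suc<-under-lifted {R} {R′} {j} x R<R′ with below-exists R<R′
    ... | R₁ , e = <-≤-trans (≤∧≢⇒< (<-below j e) (λ q → succNotBelow x R₁ e (sym q)))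
                             (col-mono j (subst (_≤ toℕ R′) (sym (toℕ-below e)) R<R′))

    raise-ssyt : IsSSYT r c t (raise B X)
    raise-ssyt = bound , rows , cols
      where
      bound : ∀ R j → raise B X R j < r + t
      bound R j with X R j in x
      ... | true = bounded x
      ... | false = SSYT.bounded sB R j
      rows : ∀ R j j′ → toℕ j ≤ toℕ j′ → raise B X R j ≤ raise B X R j′
      rows R j j′ j≤j′ with X R j in x | X R j′ in x′
      ... | true  | true  = s≤s (row-mono R j≤j′)
      ... | false | true  = m≤n⇒m≤1+n (row-mono R j≤j′)
      ... | false | false = row-mono R j≤j′
      ... | true  | false with m≤n⇒m<n∨m≡n j≤j′
      ...   | inj₁ j<j′ = <-right-of-lifted j′ x j<j′
      ...   | inj₂ j≡j′ = contradiction (trans (sym (subst (λ k → X R k ≡ true) (toℕ-injective j≡j′) x))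
            x′) λ ()
      cols : ∀ R R′ j → toℕ R < toℕ R′ → raise B X R j < raise B X R′ j
      cols R R′ j R<R′ with X R j in x
      ... | true = <-≤-trans (suc<-under-lifted x R<R′) (≤-raise B X R′ j)
      ... | false = <-≤-trans (col-strict j R<R′) (≤-raise B X R′ j)

    lifted-injective : ∀ {R j j′} → X R j ≡ true → X R j′ ≡ true → B R j ≡ B R j′ → j ≡ j′
    lifted-injective x x′ e =
      rightmost-unique {T = B} (e , λ j″ j<j″ q → rightmost x j″ j<j″ (trans q (sym e)))
          (refl , rightmost x′)

    lifted-free : ∀ {R j} → X R j ≡ true → Free (raise B X) R j
    lifted-free {R} {j} x R′ a q with X R′ j in x′
    ... | true = parity⇒≢ (even x) (even⇒suc-odd {B R′ j} (even x′))
          (sym (suc-injective (trans q (raise-true B X x))))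
    ... | false = <-irrefl (suc-injective (trans q (raise-true B X x))) (SSYT.>-above sB j a)

    free-raise-unlifted : ∀ {R j} → X R j ≡ false → isOdd (B R j) ≡ true → Free B R j → Free (raise B X) R j
    free-raise-unlifted {R} {j} x odd free R′ a q with X R′ j in x′
    ... | true = parity⇒≢ {suc (suc (B R′ j))} (even x′) odd (trans q (raise-false B X x))
    ... | false = free R′ a (trans q (raise-false B X x))

    free-unraise-unlifted : ∀ {R j} → X R j ≡ false → Free (raise B X) R j → Free B R j
    free-unraise-unlifted {R} {j} x free R′ a q with X R′ j in x′
    ... | true = succNotBelow x′ R (above⇒below a) (sym q)
    ... | false = free R′ a (trans (cong suc (raise-false B X x′)) (trans q (sym (raise-false B X x))))

    -- Raising an even entry e affects freeness only of the raised cell and of an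
    -- entry e + 2 directly below it (e + 1 cannot be there), so for odd o the free
    -- count grows exactly by the raised cells that reach o.
    module _ {o : ℕ} (odd : isOdd o ≡ true) (R : Fin r) where

      freeOcc-raise-new : ∀ {j} → X R j ≡ true → suc (B R j) ≡ o →
        freeOcc (raise B X) R o j ≡ true × freeOcc B R o j ≡ false
      freeOcc-raise-new {j} x e =
        reflects-⇒true (freeOcc-reflects (raise B X) R o j) (trans (raise-true B X x) e , lifted-free x) ,
        reflects-⇒false (freeOcc-reflects B R o j) (λ (B≡o , _) → 1+n≢n (trans e (sym B≡o)))

      freeOcc-raise-old : ∀ {j} → ¬ (X R j ≡ true × suc (B R j) ≡ o) →
        freeOcc (raise B X) R o j ≡ freeOcc B R o j
      freeOcc-raise-old {j} ¬new =
        reflects-≡ (freeOcc-reflects (raise B X) R o j) (freeOcc-reflects B R o j) to from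
        where
        to : FreeOcc (raise B X) R o j → FreeOcc B R o j
        to (r≡o , free) with true-or-false (X R j)
        ... | inj₁ x = contradiction (x , trans (sym (raise-true B X x)) r≡o) ¬new
        ... | inj₂ x = trans (sym (raise-false B X x)) r≡o , free-unraise-unlifted x free
        from : FreeOcc B R o j → FreeOcc (raise B X) R o j
        from (B≡o , free) with true-or-false (X R j)
        ... | inj₁ x = contradiction B≡o (parity⇒≢ (even x) odd)
        ... | inj₂ x = trans (raise-false B X x) B≡o ,
                       free-raise-unlifted x (subst (λ v → isOdd v ≡ true) (sym B≡o) odd) free

      freeCount-raise-≡ : (∀ j → X R j ≡ true → suc (B R j) ≢ o) →
        freeCount (raise B X) R o ≡ freeCount B R o
      freeCount-raise-≡ none = begin
        freeCount (raise B X) R o        ≡⟨ freeCount≡count (raise B X) R o ⟩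
        count (freeOcc (raise B X) R o)  ≡⟨ count-cong (λ j → freeOcc-raise-old λ (x , e) → none j x e) ⟩
        count (freeOcc B R o)            ≡⟨ freeCount≡count B R o ⟨
        freeCount B R o                  ∎
        where open ≡-Reasoning

      freeCount-raise-suc : ∀ {j₀} → X R j₀ ≡ true → suc (B R j₀) ≡ o →
        freeCount (raise B X) R o ≡ suc (freeCount B R o)
      freeCount-raise-suc {j₀} x₀ e₀ = begin
        freeCount (raise B X) R o        ≡⟨ freeCount≡count (raise B X) R o ⟩
        count (freeOcc (raise B X) R o)  ≡⟨ count-insert j₀ (proj₁ new) (proj₂ new) old ⟩
        suc (count (freeOcc B R o))      ≡⟨ cong suc (freeCount≡count B R o) ⟨
        suc (freeCount B R o)            ∎
        where
        open ≡-Reasoning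
        new : freeOcc (raise B X) R o j₀ ≡ true × freeOcc B R o j₀ ≡ false
        new = freeOcc-raise-new x₀ e₀
        old : ∀ j → j ≢ j₀ → freeOcc (raise B X) R o j ≡ freeOcc B R o j
        old j j≢j₀ = freeOcc-raise-old λ (x , e) →
          j≢j₀ (lifted-injective x x₀ (suc-injective (trans e (sym e₀))))


module _ {r c : ℕ} where

  changed : Array r c → Array r c → Cells r c
  changed B T R j = not (T R j ≡ᵇ B R j)

  changed-raise : ∀ B X R j → changed B (raise B X) R j ≡ X R j
  changed-raise B X R j with X R j
  ... | true = cong not (reflects-⇒false (≡ᵇ-reflects-≡ (suc (B R j)) (B R j)) 1+n≢n)
  ... | false = cong not (reflects-⇒true (≡ᵇ-reflects-≡ (B R j) (B R j)) refl)

  module _ {B T : Array r c} {F : Cells r c} (B≤T : B ≤A T) (T≤ : T ≤A raise B F) where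

    between-raise : ∀ R j → T R j ≡ B R j ⊎ (F R j ≡ true × T R j ≡ suc (B R j))
    between-raise R j with true-or-false (F R j)
    ... | inj₂ f = inj₁ (≤-antisym (subst (T R j ≤_) (raise-false B F f) (T≤ R j)) (B≤T R j))
    ... | inj₁ f with m≤n⇒m<n∨m≡n (B≤T R j)
    ...   | inj₁ B<T = inj₂ (f , ≤-antisym (subst (T R j ≤_) (raise-true B F f) (T≤ R j)) B<T)
    ...   | inj₂ B≡T = inj₁ (sym B≡T)

    private
      changed-≡ : ∀ {R j} → T R j ≡ B R j → changed B T R j ≡ false
      changed-≡ {R} {j} e = cong not (reflects-⇒true (≡ᵇ-reflects-≡ (T R j) (B R j)) e)

      changed-suc : ∀ {R j} → T R j ≡ suc (B R j) → changed B T R j ≡ true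
      changed-suc {R} {j} e =
        cong not (reflects-⇒false (≡ᵇ-reflects-≡ (T R j) (B R j)) (λ q → 1+n≢n (trans (sym e) q)))

    changed-⊆ : changed B T ⊆ᶜ F
    changed-⊆ R j ch with between-raise R j
    ... | inj₁ T≡B = contradiction (trans (sym ch) (changed-≡ T≡B)) λ ()
    ... | inj₂ (f , _) = f

    ≋-raise-changed : T ≋ raise B (changed B T)
    ≋-raise-changed R j with between-raise R j
    ... | inj₁ T≡B = trans T≡B (sym (raise-false B (changed B T) (changed-≡ T≡B)))
    ... | inj₂ (_ , T≡suc) = trans T≡suc (sym (raise-true B (changed B T) (changed-suc T≡suc)))

  ≤A⇔changed-⊆ : ∀ {B T U : Array r c} {F} → B ≤A T → T ≤A raise B F → B ≤A U → U ≤A raise B F →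
    (T ≤A U) ⇔ (changed B T ⊆ᶜ changed B U)
  ≤A⇔changed-⊆ {B} {T} {U} B≤T T≤ B≤U U≤ = mk⇔
    (λ T≤U → raise-≤⇒⊆ B λ R j → subst₂ _≤_ (≋T R j) (≋U R j) (T≤U R j))
    (λ T⊆U R j → subst₂ _≤_ (sym (≋T R j)) (sym (≋U R j)) (raise-mono B T⊆U R j))
    where
    ≋T : T ≋ raise B (changed B T)
    ≋T = ≋-raise-changed B≤T T≤
    ≋U : U ≋ raise B (changed B U)
    ≋U = ≋-raise-changed B≤U U≤

-- An element of [B, raise B F] is the raise of the cells where it differs from B,
-- a subset of F; enumerating F turns that subset into a Subset.
module _ {r c t : ℕ} {B : Array r c} {F : Cells r c}
         (ssyt-raise : ∀ Y → Y ⊆ᶜ F → IsSSYT r c t (raise B Y)) where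

  private
    cellsF : Fin (r * c) → Bool
    cellsF i = uncurry F (remQuot c i)

    open Enumeration (enumerate cellsF)

    cell : Fin size → Fin r × Fin c
    cell k = remQuot c (elem k)

    selection : Subset size → Cells r c
    selection s R j = Maybe.maybe (Vec.lookup s) false (index (combine R j))

    cellsF-combine : ∀ R j → cellsF (combine R j) ≡ F R j
    cellsF-combine R j = cong (uncurry F) (remQuot-combine R j)

    selection⊆F : ∀ s → selection s ⊆ᶜ F
    selection⊆F s R j _ with index (combine R j) in e
    ... | just k = begin
      F R j                ≡⟨ cellsF-combine R j ⟨
      cellsF (combine R j) ≡⟨ cong cellsF (elem-index e) ⟨
      cellsF (elem k)      ≡⟨ elem-true k ⟩
      true                 ∎
      where open ≡-Reasoning

    selection-mono : ∀ {s s′} → s ⊆ s′ → selection s ⊆ᶜ selection s′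
    selection-mono {s} {s′} s⊆s′ R j sel with index (combine R j)
    ... | just k = []=⇒lookup (s⊆s′ (lookup⇒[]= k s sel))

    selection-cell : ∀ s k → uncurry (selection s) (cell k) ≡ Vec.lookup s k
    selection-cell s k =
      cong (Maybe.maybe (Vec.lookup s) false)
          (trans (cong index (combine-remQuot {r} c (elem k))) (index-elem k))

    Elem : Set
    Elem = Interval r c t B (raise B F)

    from : Subset size → Elem
    from s = raise B (selection s) , ssyt-raise _ (selection⊆F s) , ≤-raise B _ , raise-mono B (selection⊆F s)

    to : Elem → Subset size
    to (T , _) = Vec.tabulate (uncurry (changed B T) ∘ cell)

    selection-to : ∀ x R j → selection (to x) R j ≡ changed B (proj₁ x) R j
    selection-to (T , _ , B≤T , T≤) R j with index (combine R j) in e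
    ... | just k = trans (lookup∘tabulate _ k)
                         (cong (uncurry (changed B T))
                           (trans (cong (remQuot c) (elem-index e)) (remQuot-combine R j)))
    ... | nothing with true-or-false (changed B T R j)
    ...   | inj₂ unchanged = sym unchanged
    ...   | inj₁ ch = contradiction (trans (sym (changed-⊆ B≤T T≤ R j ch))
                                           (trans (sym (cellsF-combine R j)) (index-nothing e))) λ ()

    from∘to : ∀ x → proj₁ (from (to x)) ≋ proj₁ x
    from∘to x@(T , _ , B≤T , T≤) R j =
      trans (cong (if_then suc (B R j) else B R j) (selection-to x R j))
            (sym (≋-raise-changed B≤T T≤ R j))

    to∘from : ∀ s → to (from s) ≡ s
    to∘from s = trans (tabulate-cong λ k → trans (uncurry (changed-raise B (selection s)) (cell k))
                                                  (selection-cell s k))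
                      (tabulate∘lookup s)

    changed-⊆⇔to-⊆ : ∀ x y → (changed B (proj₁ x) ⊆ᶜ changed B (proj₁ y)) ⇔ (to x ⊆ to y)
    changed-⊆⇔to-⊆ x y = mk⇔
      (λ ch⊆ {k} k∈x → lookup⇒[]= k (to y) (trans (lookup∘tabulate _ k)
        (uncurry (ch⊆) (cell k) (trans (sym (lookup∘tabulate _ k)) ([]=⇒lookup k∈x)))))
      (λ to⊆ R j ch → trans (sym (selection-to y R j))
        (selection-mono to⊆ R j (trans (selection-to x R j) ch)))

  boolean-interval : IsBooleanInterval r c t B (raise B F)
  boolean-interval = record
    { n = size ; to = to ; from = from ; from∘to = from∘to ; to∘from = to∘from
    ; monotone = λ x@(_ , _ , B≤T , T≤) y@(_ , _ , B≤U , U≤) →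
        changed-⊆⇔to-⊆ x y ⇔-∘ ≤A⇔changed-⊆ B≤T T≤ B≤U U≤ }

module _ {r c : ℕ} where

  EvenFreeCounts : Array r c → Set
  EvenFreeCounts B = ∀ R o → isOdd o ≡ true → isOdd (freeCount B R o) ≡ false

  odd-freeCount⇒occurs : ∀ (T : Array r c) R v → isOdd (freeCount T R v) ≡ true → ∃ λ j → T R j ≡ v
  odd-freeCount⇒occurs T R v odd =
    let j , occ = count≢0⇒witness (freeOcc T R v) (λ c≡0 →
                    contradiction (trans (sym odd) (cong isOdd (trans (freeCount≡count T R v) c≡0))) λ ())
    in j , proj₁ (reflects-true⇒ (freeOcc-reflects T R v j) occ)

  noD⇒evenFreeCounts : ∀ {B : Array r c} → (∀ R i → inD B R i ≡ false) → EvenFreeCounts B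
  noD⇒evenFreeCounts {B} noD R o odd with true-or-false (isOdd (freeCount B R o))
  ... | inj₂ even = even
  ... | inj₁ fcOdd = contradiction (odd , odd-freeCount⇒occurs B R o fcOdd , fcOdd)
                                   (reflects-false⇒ (inD-reflects B R o) (noD R o))

  evenFreeCounts⇒noD : ∀ {B : Array r c} → EvenFreeCounts B → ∀ R i → inD B R i ≡ false
  evenFreeCounts⇒noD {B} even R i = reflects-⇒false (inD-reflects B R i)
    λ (odd , _ , fcOdd) → contradiction (trans (sym fcOdd) (even R i odd)) λ ()

module _ {r c t : ℕ} {B : Array r c} {X : Cells r c} where

  liftable⇒liftCells : Liftable t B X → EvenFreeCounts B → X ⊆ᶜ liftCells t B
  liftable⇒liftCells L evenFC R j x =
    cong₂ _∧_ (reflects-⇒true (inE-reflects t B R (B R j)) inE-j)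
              (reflects-⇒true (isRightmost-reflects B R (B R j) j) right)
    where
    open Liftable L
    right : RightmostOf B R (B R j) j
    right = refl , rightmost x
    inE-j : InE t B R (B R j)
    inE-j = even x , bounded x , (j , refl) ,
          (λ j′ right′ → subst (SuccNotBelow B R (B R j)) (rightmost-unique {T = B} right right′)
              (succNotBelow x)) ,
          evenFC R (suc (B R j)) (even⇒suc-odd {B R j} (even x))

module _ {r c : ℕ} where

  ≋-sym : {T U : Array r c} → T ≋ U → U ≋ T
  ≋-sym T≋U R j = sym (T≋U R j)

  ≋-trans : {T U V : Array r c} → T ≋ U → U ≋ V → T ≋ V
  ≋-trans T≋U U≋V R j = trans (T≋U R j) (U≋V R j)

  module _ {T U : Array r c} (T≋U : T ≋ U) where

    free-≋ : ∀ {R j} → Free T R j → Free U R j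
    free-≋ {R} {j} free R′ a q = free R′ a (trans (cong suc (T≋U R′ j)) (trans q (sym (T≋U R j))))

    freeOcc-≋ : ∀ {R v j} → FreeOcc T R v j → FreeOcc U R v j
    freeOcc-≋ {R} {v} {j} (T≡v , free) = trans (sym (T≋U R j)) T≡v , free-≋ free

  freeCount-≋ : {T U : Array r c} → T ≋ U → ∀ R v → freeCount T R v ≡ freeCount U R v
  freeCount-≋ {T} {U} T≋U R v = begin
    freeCount T R v       ≡⟨ freeCount≡count T R v ⟩
    count (freeOcc T R v) ≡⟨ count-cong (λ j → reflects-≡ (freeOcc-reflects T R v j) (freeOcc-reflects U R v j)
                                          (freeOcc-≋ T≋U) (freeOcc-≋ (≋-sym T≋U))) ⟩
    count (freeOcc U R v) ≡⟨ freeCount≡count U R v ⟨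
    freeCount U R v       ∎
    where open ≡-Reasoning

  Lowerable : Array r c → Fin r → Fin c → Set
  Lowerable T R j = InD T R (T R j) × LeftmostOf T R (T R j) j

  -- The leftmost i in row R for each (R, i) ∈ D(T): the cells decremented to reach T_bottom.
  lowerCells : Array r c → Cells r c
  lowerCells T R j = inD T R (T R j) ∧ isLeftmost T R (T R j) j

  lowerCells-reflects : ∀ T R j → Reflects (Lowerable T R j) (lowerCells T R j)
  lowerCells-reflects T R j = inD-reflects T R (T R j) ×-reflects isLeftmost-reflects T R (T R j) j

  lower : Array r c → Array r c
  lower T R j = if lowerCells T R j then pred (T R j) else T R j

  lowerable-≋ : {T U : Array r c} → T ≋ U → ∀ {R j} → Lowerable T R j → Lowerable U R j
  lowerable-≋ {T} {U} T≋U {R} {j} ((odd , (j′ , occ) , fcOdd) , (_ , left)) =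
    (subst (λ v → isOdd v ≡ true) (T≋U R j) odd ,
     (j′ , trans (sym (T≋U R j′)) (trans occ (T≋U R j))) ,
     subst (λ v → isOdd v ≡ true) (trans (freeCount-≋ T≋U R (T R j)) (cong (freeCount U R) (T≋U R j)))
         fcOdd) ,
    (refl , λ j″ j″<j q → left j″ j″<j (trans (T≋U R j″) (trans q (sym (T≋U R j)))))

  lower-≋ : {T U : Array r c} → T ≋ U → lower T ≋ lower U
  lower-≋ {T} {U} T≋U R j = cong₂ (λ b v → if b then pred v else v)
    (reflects-≡ (lowerCells-reflects T R j) (lowerCells-reflects U R j)
        (lowerable-≋ T≋U) (lowerable-≋ (≋-sym T≋U)))
    (T≋U R j)

module _ {r c t : ℕ} {B : Array r c} {X : Cells r c}
         (sB : IsSSYT r c t B) (evenFC : EvenFreeCounts B) (L : Liftable t B X) where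
  open Liftable L

  lifted⇒lowerable : ∀ {R j} → X R j ≡ true → Lowerable (raise B X) R j
  lifted⇒lowerable {R} {j} x = (odd , (j , refl) , fcOdd) , (refl , left)
    where
    raised : raise B X R j ≡ suc (B R j)
    raised = raise-true B X x
    sucOdd : isOdd (suc (B R j)) ≡ true
    sucOdd = even⇒suc-odd {B R j} (even x)
    odd : isOdd (raise B X R j) ≡ true
    odd = subst (λ v → isOdd v ≡ true) (sym raised) sucOdd
    fcOdd : isOdd (freeCount (raise B X) R (raise B X R j)) ≡ true
    fcOdd = subst (λ v → isOdd v ≡ true)
      (sym (trans (cong (freeCount (raise B X) R) raised) (freeCount-raise-suc sB L sucOdd R x refl)))
      (even⇒suc-odd {freeCount B R (suc (B R j))} (evenFC R (suc (B R j)) sucOdd))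
    left : ∀ j′ → toℕ j′ < toℕ j → raise B X R j′ ≢ raise B X R j
    left j′ j′<j q with true-or-false (X R j′)
    ... | inj₁ x′ = rightmost x′ j j′<j
          (suc-injective (trans (sym raised) (trans (sym q) (raise-true B X x′))))
    ... | inj₂ x′ = 1+n≰n (subst (_≤ B R j) (trans (sym (raise-false B X x′)) (trans q raised))
                                 (SSYT.row-mono sB R (<⇒≤ j′<j)))

  unlifted⇒¬lowerable : ∀ {R j} → X R j ≡ false → ¬ Lowerable (raise B X) R j
  unlifted⇒¬lowerable {R} {j} x ((odd , _ , fcOdd) , (_ , left))
    with any? (λ k → (X R k Bool.≟ true) ×-dec (suc (B R k) ≟ raise B X R j))
  ... | yes (k , xk , e) with <-cmp (toℕ k) (toℕ j)
  ...   | tri< k<j _ _ = left k k<j (trans (raise-true B X xk) e)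
  ...   | tri≈ _ k≡j _ = contradiction (trans (sym xk)
        (subst (λ k → X R k ≡ false) (sym (toℕ-injective k≡j)) x)) λ ()
  ...   | tri> _ _ j<k = 1+n≰n (subst (_≤ B R k) (trans (sym (raise-false B X x)) (sym e))
        (SSYT.row-mono sB R (<⇒≤ j<k)))
  unlifted⇒¬lowerable {R} {j} x ((odd , _ , fcOdd) , _) | no none =
    contradiction (trans (sym fcOdd) (trans (cong isOdd unchanged) (evenFC R _ odd))) λ ()
    where
    unchanged : freeCount (raise B X) R (raise B X R j) ≡ freeCount B R (raise B X R j)
    unchanged = freeCount-raise-≡ sB L odd R λ k xk e → none (k , xk , e)

  lowerCells-raise : ∀ R j → lowerCells (raise B X) R j ≡ X R j
  lowerCells-raise R j with true-or-false (X R j)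
  ... | inj₁ x = trans (reflects-⇒true (lowerCells-reflects (raise B X) R j) (lifted⇒lowerable x)) (sym x)
  ... | inj₂ x = trans (reflects-⇒false (lowerCells-reflects (raise B X) R j) (unlifted⇒¬lowerable x))
        (sym x)

  lower-raise : lower (raise B X) ≋ B
  lower-raise R j rewrite lowerCells-raise R j with X R j
  ... | true = refl
  ... | false = refl

odd⇒suc-pred : isOdd n ≡ true → suc (pred n) ≡ n
odd⇒suc-pred {suc n} _ = refl

module _ {r c t : ℕ} {T : Array r c} (sT : IsSSYT r c t T) where
  open SSYT sT

  private
    lowerable : ∀ {R j} → lowerCells T R j ≡ true → Lowerable T R j
    lowerable {R} {j} = reflects-true⇒ (lowerCells-reflects T R j)

  lowered-suc : ∀ {R j} → lowerCells T R j ≡ true → T R j ≡ suc (lower T R j)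
  lowered-suc {R} {j} x rewrite x = sym (odd⇒suc-pred (proj₁ (proj₁ (lowerable x))))

  unlowered : ∀ {R j} → lowerCells T R j ≡ false → lower T R j ≡ T R j
  unlowered x rewrite x = refl

  lower-≤ : lower T ≤A T
  lower-≤ R j with lowerCells T R j
  ... | true = pred[n]≤n
  ... | false = ≤-refl

  raise-lower : T ≋ raise (lower T) (lowerCells T)
  raise-lower R j with true-or-false (lowerCells T R j)
  ... | inj₁ x = trans (lowered-suc x) (sym (raise-true (lower T) (lowerCells T) x))
  ... | inj₂ x = trans (sym (unlowered x)) (sym (raise-false (lower T) (lowerCells T) x))

  -- Were the leftmost o directly under o - 1, so would every o of the row, and
  -- none of them would be free.
  lowered-free : ∀ {R j} → lowerCells T R j ≡ true → Free T R j
  lowered-free {R} {j} x R₀ a q =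
    contradiction (trans (sym fcOdd) (cong isOdd noFreeOcc)) λ ()
    where
    fcOdd : isOdd (freeCount T R (T R j)) ≡ true
    fcOdd = proj₂ (proj₂ (proj₁ (lowerable x)))
    left : ∀ j′ → toℕ j′ < toℕ j → T R j′ ≢ T R j
    left = proj₂ (proj₂ (lowerable x))
    notFree : ∀ j′ → ¬ FreeOcc T R (T R j) j′
    notFree j′ (T≡ , free) = free R₀ a (≤-antisym (>-above j′ a) (begin
      T R j′         ≡⟨ T≡ ⟩
      T R j          ≡⟨ q ⟨
      suc (T R₀ j)   ≤⟨ s≤s (row-mono R₀ (≮⇒≥ λ j′<j → left j′ j′<j T≡)) ⟩
      suc (T R₀ j′)  ∎))
      where open ≤-Reasoning
    noFreeOcc : freeCount T R (T R j) ≡ 0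
    noFreeOcc = trans (freeCount≡count T R (T R j))
      (count-false λ j′ → reflects-⇒false (freeOcc-reflects T R (T R j) j′) (notFree j′))

  lower-ssyt : IsSSYT r c t (lower T)
  lower-ssyt = (λ R j → ≤-<-trans (lower-≤ R j) (bounded R j)) , rows , cols
    where
    rows : ∀ R j j′ → toℕ j ≤ toℕ j′ → lower T R j ≤ lower T R j′
    rows R j j′ j≤j′ with true-or-false (lowerCells T R j′)
    ... | inj₂ x′ = ≤-trans (lower-≤ R j) (≤-trans (row-mono R j≤j′) (≤-reflexive (sym (unlowered x′))))
    ... | inj₁ x′ with m≤n⇒m<n∨m≡n j≤j′
    ...   | inj₂ j≡j′ rewrite toℕ-injective j≡j′ = ≤-refl
    ...   | inj₁ j<j′ = ≤-trans (lower-≤ R j) (s≤s⁻¹ (begin-strict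
            T R j               <⟨ ≤∧≢⇒< (row-mono R j≤j′) (proj₂ (proj₂ (lowerable x′)) j j<j′) ⟩
            T R j′              ≡⟨ lowered-suc x′ ⟩
            suc (lower T R j′)  ∎))
      where open ≤-Reasoning
    cols : ∀ R R′ j → toℕ R < toℕ R′ → lower T R j < lower T R′ j
    cols R R′ j R<R′ with true-or-false (lowerCells T R′ j)
    ... | inj₂ x′ = ≤-<-trans (lower-≤ R j)
          (<-≤-trans (col-strict j R<R′) (≤-reflexive (sym (unlowered x′))))
    ... | inj₁ x′ with above-exists R<R′
    ...   | R₀ , a = s≤s⁻¹ (begin-strict
            suc (lower T R j)   ≤⟨ s≤s (lower-≤ R j) ⟩
            suc (T R j)         ≤⟨ s≤s (col-mono j (s≤s⁻¹ (subst (suc (toℕ R) ≤_) (toℕ-above a) R<R′))) ⟩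
            suc (T R₀ j)        <⟨ ≤∧≢⇒< (>-above j a) (lowered-free x′ R₀ a) ⟩
            T R′ j              ≡⟨ lowered-suc x′ ⟩
            suc (lower T R′ j)  ∎)
      where open ≤-Reasoning

  lowerCells-liftable : Liftable t (lower T) (lowerCells T)
  lowerCells-liftable = record
    { even = lowered-even
    ; rightmost = rightmost
    ; succNotBelow = succNotBelow
    ; bounded = λ {R} {j} x → subst (_< r + t) (lowered-suc x) (bounded R j) }
    where
    lowered-even : ∀ {R j} → lowerCells T R j ≡ true → isOdd (lower T R j) ≡ false
    lowered-even {R} {j} x =
      suc-odd⇒even {lower T R j}
          (subst (λ v → isOdd v ≡ true) (lowered-suc x) (proj₁ (proj₁ (lowerable x))))
    rightmost : ∀ {R j} → lowerCells T R j ≡ true → ∀ j′ → toℕ j < toℕ j′ → lower T R j′ ≢ lower T R j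
    rightmost {R} {j} x j′ j<j′ q with true-or-false (lowerCells T R j′)
    ... | inj₁ x′ = proj₂ (proj₂ (lowerable x′)) j j<j′
                      (trans (lowered-suc x) (trans (cong suc (sym q)) (sym (lowered-suc x′))))
    ... | inj₂ x′ = 1+n≰n (begin
      suc (lower T R j)  ≡⟨ lowered-suc x ⟨
      T R j              ≤⟨ row-mono R (<⇒≤ j<j′) ⟩
      T R j′             ≡⟨ unlowered x′ ⟨
      lower T R j′       ≡⟨ q ⟩
      lower T R j        ∎)
      where open ≤-Reasoning
    succNotBelow : ∀ {R j} → lowerCells T R j ≡ true → SuccNotBelow (lower T) R (lower T R j) j
    succNotBelow {R} {j} x R₁ b q with true-or-false (lowerCells T R₁ j)
    ... | inj₁ x₁ = parity⇒≢ {suc (suc (lower T R j))} (lowered-even x) (proj₁ (proj₁ (lowerable x₁)))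
                      (sym (trans (lowered-suc x₁) (cong suc q)))
    ... | inj₂ x₁ = <-irrefl (trans (lowered-suc x) (trans (sym q) (unlowered x₁))) (<-below j b)

  oddFreeCount⇒lowered : ∀ {R o} → isOdd o ≡ true → isOdd (freeCount T R o) ≡ true →
    ∃ λ j → lowerCells T R j ≡ true × T R j ≡ o
  oddFreeCount⇒lowered {R} {o} odd fcOdd = j₁ , reflects-⇒true (lowerCells-reflects T R j₁) lowerable₁ , T≡o
    where
    occurrence : ∃ λ j → T R j ≡ o
    occurrence = odd-freeCount⇒occurs T R o fcOdd
    leftmost : ∃ λ j₁ → (T R j₁ ≡ᵇ o) ≡ true × ∀ j′ → toℕ j′ < toℕ j₁ → (T R j′ ≡ᵇ o) ≡ false
    leftmost = leftmost-witness (λ k → T R k ≡ᵇ o) (proj₁ occurrence)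
                 (reflects-⇒true (≡ᵇ-reflects-≡ _ o) (proj₂ occurrence))
    j₁ : Fin c
    j₁ = proj₁ leftmost
    T≡o : T R j₁ ≡ o
    T≡o = reflects-true⇒ (≡ᵇ-reflects-≡ _ o) (proj₁ (proj₂ leftmost))
    lowerable₁ : Lowerable T R j₁
    lowerable₁ =
      (subst (λ v → isOdd v ≡ true) (sym T≡o) odd , (j₁ , refl) ,
       subst (λ v → isOdd (freeCount T R v) ≡ true) (sym T≡o) fcOdd) ,
      (refl , λ j′ j′<j₁ q → reflects-false⇒ (≡ᵇ-reflects-≡ _ o) (proj₂ (proj₂ leftmost) j′ j′<j₁)
                               (trans q T≡o))

  lower-evenFreeCounts : EvenFreeCounts (lower T)
  lower-evenFreeCounts R o odd
    with any? (λ k → (lowerCells T R k Bool.≟ true) ×-dec (suc (lower T R k) ≟ o))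
  ... | yes (k , xk , e) =
    suc-odd⇒even {freeCount (lower T) R o}
        (subst (λ v → isOdd v ≡ true) fc≡ (proj₂ (proj₂ (proj₁ (lowerable xk)))))
    where
    open ≡-Reasoning
    fc≡ : freeCount T R (T R k) ≡ suc (freeCount (lower T) R o)
    fc≡ = begin
      freeCount T R (T R k)                           ≡⟨ cong (freeCount T R) (trans (lowered-suc xk) e) ⟩
      freeCount T R o                                 ≡⟨ freeCount-≋ raise-lower R o ⟩
      freeCount (raise (lower T) (lowerCells T)) R o  ≡⟨ freeCount-raise-suc lower-ssyt lowerCells-liftable odd R xk e ⟩
      suc (freeCount (lower T) R o)                   ∎
  ... | no none with true-or-false (isOdd (freeCount (lower T) R o))
  ...   | inj₂ even = even
  ...   | inj₁ fcOdd =
    let j₁ , x₁ , T≡o = oddFreeCount⇒lowered odd fcTOdd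
    in ⊥-elim (none (j₁ , x₁ , trans (sym (lowered-suc x₁)) T≡o))
    where
    fcTOdd : isOdd (freeCount T R o) ≡ true
    fcTOdd = subst (λ v → isOdd v ≡ true) (sym (trans (freeCount-≋ raise-lower R o)
               (freeCount-raise-≡ lower-ssyt lowerCells-liftable odd R λ k xk e → none (k , xk , e))))
                   fcOdd

  ≤-Top-lower : T ≤A Top r t (lower T)
  ≤-Top-lower R j = subst (_≤ Top r t (lower T) R j) (sym (raise-lower R j))
    (raise-mono (lower T) (liftable⇒liftCells lowerCells-liftable lower-evenFreeCounts) R j)

bottom≋lower : ∀ {r c t} {B T : Array r c} → IsBottom r c t B → B ≤A T → T ≤A Top r t B → B ≋ lower T
bottom≋lower {t = t} {B} {T} (sB , noD) B≤T T≤ =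
  ≋-sym (≋-trans (lower-≋ (≋-raise-changed B≤T T≤))
      (lower-raise sB (noD⇒evenFreeCounts {B = B} noD) changed-liftable))
  where
  changed-liftable : Liftable t B (changed B T)
  changed-liftable = liftable-⊆ (liftCells-liftable B) (changed-⊆ B≤T T≤)

theorem5p10 : (r c t : ℕ) → 1 ≤ r → 1 ≤ c → 1 ≤ t →
    ((B : Array r c) → IsBottom r c t B → IsBooleanInterval r c t B (Top r t B)) ×
    ((T : Array r c) → IsSSYT r c t T →
      ∃ λ B → IsBottom r c t B × InInterval r c t B (Top r t B) T) ×
    ((T B B′ : Array r c) → IsBottom r c t B → IsBottom r c t B′ →
      InInterval r c t B (Top r t B) T → InInterval r c t B′ (Top r t B′) T → B ≋ B′)
theorem5p10 r c t _ _ _ =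
  (λ B (sB , _) → boolean-interval λ Y Y⊆ → raise-ssyt sB (liftable-⊆ (liftCells-liftable B) Y⊆)) ,
  (λ T sT → lower T , (lower-ssyt sT , evenFreeCounts⇒noD {B = lower T} (lower-evenFreeCounts sT)) ,
      sT , lower-≤ sT , ≤-Top-lower sT) ,
  (λ T B B′ bottom bottom′ (_ , B≤T , T≤) (_ , B′≤T , T≤′) →
     ≋-trans (bottom≋lower bottom B≤T T≤) (≋-sym (bottom≋lower bottom′ B′≤T T≤′)))
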